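{- Let $k \geq 2$ and let $\mathcal{H}$ be a hypergraph such that $\delta(\mathcal{H}) \geq 2^{k-2}+1$. Then $\mathcal{H}$ contains a Berge path with $k$ base vertices.
   Context: A hypergraph $\mathcal{H}$ is a finite vertex set $V(\mathcal{H})$ together with a set $E(\mathcal{H})$ of subsets of $V(\mathcal{H})$ (the hyperedges), with no restriction on their sizes. Hypergraphs are simple: no hyperedge is repeated. The degree of a vertex is the number of hyperedges containing it, and $\delta(\mathcal{H})$ is the minimum degree. A Berge path of length $\ell$ consists of $\ell+1$ distinct vertices $v_1, \ldots, v_{\ell+1}$ (the base, or representative, vertices) and $\ell$ distinct hyperedges $e_1, \ldots, e_\ell$ such that $\{v_i, v_{i+1}\} \subseteq e_i$ for all $1 \leq i \leq \ell$. A Berge path with $k$ base vertices is one of length $k-1$. -}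

module Defs where

open import Data.Nat using (ℕ; suc; _+_; _^_; _∸_; _≤_)
open import Data.Fin using (Fin; inject₁; suc)
open import Data.Fin.Subset using (Subset; _∈_)
open import Data.Vec using (Vec; lookup)
open import Data.List using (List; filter; length)
open import Data.List using () renaming (allFin to allFinL)
open import Data.Fin.Subset.Properties using (_∈?_)
open import Data.Product using (Σ; _×_; _,_)
open import Function.Definitions using (Injective)
open import Relation.Binary.PropositionalEquality using (_≡_)

record Hypergraph (n : ℕ) : Set where
  field
    m      : ℕ
    edge   : Fin m → Subset n
    simple : Injective _≡_ _≡_ edge
open Hypergraph public

degree : ∀ {n} → Hypergraph n → Fin n → ℕ
degree H v = length (filter (λ i → v ∈? edge H i) (allFinL (m H)))

MinDegreeAtLeast : ∀ {n} → Hypergraph n → ℕ → Set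
MinDegreeAtLeast {n} H d = (v : Fin n) → d ≤ degree H v

record BergePath {n} (H : Hypergraph n) (ℓ : ℕ) : Set where
  field
    vert      : Fin (suc ℓ) → Fin n
    edg       : Fin ℓ → Fin (m H)
    vert-inj  : Injective _≡_ _≡_ vert
    edg-inj   : Injective _≡_ _≡_ edg
    incident  : (i : Fin ℓ) →
                (vert (inject₁ i) ∈ edge H (edg i)) × (vert (suc i) ∈ edge H (edg i))

-- H contains a Berge path with k base vertices (i.e. of length k - 1), k ≥ 1
HasBergePathWithBase : ∀ {n} → Hypergraph n → ℕ → Set
HasBergePathWithBase H k = BergePath H (k ∸ 1)

-- Induction on the path length, for simple edge lists whose vertex set is the union of the edges.
-- Given a start vertex v, pick an edge e₀ ∋ v with a second vertex w and delete v from every edge,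
-- discarding e₀ and every edge e ∋ v whose trace e - v is already an edge (so the result stays
-- simple). A vertex x ≠ v then loses exactly the discarded edges through it. If some edge with
-- nonempty trace collapses in this way, it is taken as e₀, and d ↦ d - v injects the discarded
-- edges through x into the kept ones, so x keeps at least half of its degree; otherwise x loses
-- at most e₀. Either way minimum degree 2 ^ (ℓ + 1) + 1 leaves minimum degree 2 ^ ℓ + 1, and a
-- Berge path of length ℓ from w in the reduced edge list extends by v and e₀.
module Submission where

open import Level using (Level)
open import Data.Bool using (true; false) renaming (_≟_ to _≟ᵇ_)
open import Data.Fin using (Fin; zero; suc; inject₁; _≟_)
open import Data.Fin.Subset using (Subset; _∈_; _∉_; _⊆_; _-_; ⁅_⁆; Nonempty; Empty)
open import Data.Fin.Subset.Properties
  using (_∈?_; x∈p∧x∉q⇒x∈p─q; p─q⊆p; x∈⁅x⁆; x∈⁅y⁆⇒x≡y; ⊆-antisym; nonempty?)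
open import Data.List using (List; []; _∷_; [_]; filter; length; map; allFin)
open import Data.List.Properties
  using (length-map; length-removeAt′; filter-accept; filter-reject; filter-≐)
open import Data.List.Membership.Propositional using (_─_; find; lose) renaming (_∈_ to _∈ˡ_)
open import Data.List.Membership.Propositional.Properties using (∈-map⁻; ∈-filter⁺; ∈-filter⁻)
open import Data.List.Relation.Unary.Any using (Any; here; there; index; any?)
open import Data.List.Relation.Unary.All as All using (_∷_)
import Data.List.Relation.Unary.All.Properties as All
open import Data.List.Relation.Unary.Unique.Propositional using (Unique; []; _∷_)
import Data.List.Relation.Unary.Unique.Propositional.Properties as Unique
open import Data.Nat using (ℕ; zero; suc; _+_; _*_; _^_; _∸_; _≤_; _<_; z≤n; s≤s)
open import Data.Nat.Properties
  using (≤-refl; ≤-reflexive; ≤-trans; ≤-pred; n<1+n; m≤n+m; +-suc; +-identityʳ; *-suc;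
         *-distribˡ-+; +-monoˡ-≤; +-monoˡ-<; *-cancelˡ-<; ^-monoʳ-<; module ≤-Reasoning)
open import Data.Product using (∃; ∃₂; _×_; _,_; proj₁; proj₂)
import Data.Product as Product
open import Data.Sum using (_⊎_; inj₁; inj₂)
import Data.Sum as Sum
open import Data.Vec using (_∷_; there)
import Data.Vec.Functional as Vector
open import Data.Vec.Properties using (≡-dec)
open import Function using (_∘_)
open import Function.Definitions using (Injective)
open import Relation.Nullary using (yes; no; ¬_; contradiction; does; _×-dec_; _⊎-dec_)
open import Relation.Unary using (Pred; Decidable; _≐_)
open import Relation.Unary.Properties using (∁?)
open import Relation.Binary.PropositionalEquality
  using (_≡_; _≢_; refl; sym; trans; cong; subst; module ≡-Reasoning)

open import Defs

private variable
  a b p q : Level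
  A : Set a
  B : Set b
  n : ℕ

module _ {P : Pred A p} (P? : Decidable P) where

  filter-map : (f : B → A) → ∀ xs → filter P? (map f xs) ≡ map f (filter (P? ∘ f) xs)
  filter-map f [] = refl
  filter-map f (x ∷ xs) with does (P? (f x))
  ... | true  = cong (f x ∷_) (filter-map f xs)
  ... | false = filter-map f xs

  length-filter+length-filter-∁ : ∀ xs →
    length (filter P? xs) + length (filter (∁? P?) xs) ≡ length xs
  length-filter+length-filter-∁ [] = refl
  length-filter+length-filter-∁ (x ∷ xs) with does (P? x)
  ... | true  = cong suc (length-filter+length-filter-∁ xs)
  ... | false = trans (+-suc _ _) (cong suc (length-filter+length-filter-∁ xs))

  module _ {Q : Pred A q} (Q? : Decidable Q) where

    filter-comm : ∀ xs → filter P? (filter Q? xs) ≡ filter Q? (filter P? xs)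
    filter-comm [] = refl
    filter-comm (x ∷ xs) with P? x | Q? x
    ... | yes px | yes qx
      rewrite filter-accept P? {xs = filter Q? xs} px | filter-accept Q? {xs = filter P? xs} qx
      = cong (x ∷_) (filter-comm xs)
    ... | yes _   | no ¬qx rewrite filter-reject Q? {xs = filter P? xs} ¬qx = filter-comm xs
    ... | no ¬px | yes _   rewrite filter-reject P? {xs = filter Q? xs} ¬px = filter-comm xs
    ... | no _    | no _    = filter-comm xs

∈-─⁺ : ∀ {x y} {ys : List A} (x∈ys : x ∈ˡ ys) → y ∈ˡ ys → y ≢ x → y ∈ˡ ys ─ x∈ys
∈-─⁺ (here refl) (here refl) y≢x = contradiction refl y≢x
∈-─⁺ (here refl) (there y∈ys) _  = y∈ys
∈-─⁺ (there _)   (here refl) _   = here refl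
∈-─⁺ (there x∈ys) (there y∈ys) y≢x = there (∈-─⁺ x∈ys y∈ys y≢x)

Unique-length-≤ : ∀ {xs ys : List A} → Unique xs → (∀ {y} → y ∈ˡ xs → y ∈ˡ ys) →
                  length xs ≤ length ys
Unique-length-≤ {xs = []} _ _ = z≤n
Unique-length-≤ {xs = x ∷ xs} {ys} (x∉xs ∷ u) xs⊆ys = begin
  suc (length xs)           ≤⟨ s≤s (Unique-length-≤ u xs⊆ys─x) ⟩
  suc (length (ys ─ x∈ys))  ≡⟨ length-removeAt′ ys (index x∈ys) ⟨
  length ys                 ∎
  where
  open ≤-Reasoning
  x∈ys = xs⊆ys (here refl)
  xs⊆ys─x : ∀ {y} → y ∈ˡ xs → y ∈ˡ ys ─ x∈ys
  xs⊆ys─x y∈xs = ∈-─⁺ x∈ys (xs⊆ys (there y∈xs)) (All.lookup x∉xs y∈xs ∘ sym)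

map⁺-injectiveOn : ∀ {f : A → B} {xs} → (∀ {x y} → x ∈ˡ xs → y ∈ˡ xs → f x ≡ f y → x ≡ y) →
                   Unique xs → Unique (map f xs)
map⁺-injectiveOn {xs = []} _ [] = []
map⁺-injectiveOn {xs = x ∷ xs} inj (x∉xs ∷ u) =
  All.map⁺ (All.tabulate (λ y∈xs fx≡fy → All.lookup x∉xs y∈xs (inj (here refl) (there y∈xs) fx≡fy)))
  ∷ map⁺-injectiveOn (λ x∈ y∈ → inj (there x∈) (there y∈)) u

Unique-distinct-pair : ∀ {xs : List A} → Unique xs → 2 ≤ length xs →
                       ∃₂ λ x y → x ∈ˡ xs × y ∈ˡ xs × x ≢ y
Unique-distinct-pair {xs = x ∷ y ∷ _} ((x≢y ∷ _) ∷ _) _ =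
  x , y , here refl , there (here refl) , x≢y
Unique-distinct-pair {xs = _ ∷ []} _ (s≤s ())

0<length⇒∃∈ : ∀ {xs : List A} → 0 < length xs → ∃ (_∈ˡ xs)
0<length⇒∃∈ {xs = x ∷ _} _ = x , here refl

∷-injective : ∀ {x : A} {f : Vector.Vector A n} →
              (∀ i → f i ≢ x) → Injective _≡_ _≡_ f → Injective _≡_ _≡_ (x Vector.∷ f)
∷-injective _   _     {zero}  {zero}  _   = refl
∷-injective f≢x _     {zero}  {suc j} x≡f = contradiction (sym x≡f) (f≢x j)
∷-injective f≢x _     {suc i} {zero}  f≡x = contradiction f≡x (f≢x i)
∷-injective _   f-inj {suc i} {suc j} f≡f = cong suc (f-inj f≡f)

x∉p-x : ∀ (p : Subset n) x → x ∉ p - x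
x∉p-x (_ ∷ p) zero    ()
x∉p-x (_ ∷ p) (suc x) (there x∈p-x) = x∉p-x p x x∈p-x

p-x⊆p : ∀ {p : Subset n} {x} → p - x ⊆ p
p-x⊆p {p = p} {x} = p─q⊆p p ⁅ x ⁆

x∈p-y⇒x≢y : ∀ {p : Subset n} {x y} → x ∈ p - y → x ≢ y
x∈p-y⇒x≢y {p = p} x∈p-x refl = x∉p-x p _ x∈p-x

x∈p∧x≢y⇒x∈p-y : ∀ {p : Subset n} {x y} → x ∈ p → x ≢ y → x ∈ p - y
x∈p∧x≢y⇒x∈p-y {y = y} x∈p x≢y = x∈p∧x∉q⇒x∈p─q x∈p (x≢y ∘ x∈⁅y⁆⇒x≡y y)

x∉p⇒p-x≡p : ∀ {p : Subset n} {x} → x ∉ p → p - x ≡ p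
x∉p⇒p-x≡p x∉p = ⊆-antisym p-x⊆p (λ y∈p → x∈p∧x≢y⇒x∈p-y y∈p λ { refl → x∉p y∈p })

p-x≡q-x⇒p≡q : ∀ {p q : Subset n} {x} → x ∈ p → x ∈ q → p - x ≡ q - x → p ≡ q
p-x≡q-x⇒p≡q {x = x} x∈p x∈q p-x≡q-x = ⊆-antisym (p⊆q x∈q p-x≡q-x) (p⊆q x∈p (sym p-x≡q-x))
  where
  p⊆q : ∀ {p q} → x ∈ q → p - x ≡ q - x → p ⊆ q
  p⊆q x∈q eq {y} y∈p with y ≟ x
  ... | yes refl = x∈q
  ... | no y≢x   = p-x⊆p (subst (y ∈_) eq (x∈p∧x≢y⇒x∈p-y y∈p y≢x))

Empty[p-x]⇒p≡⁅x⁆ : ∀ {p : Subset n} {x} → x ∈ p → Empty (p - x) → p ≡ ⁅ x ⁆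
Empty[p-x]⇒p≡⁅x⁆ {p = p} {x} x∈p empty =
  ⊆-antisym p⊆⁅x⁆ (λ y∈⁅x⁆ → subst (_∈ p) (sym (x∈⁅y⁆⇒x≡y x y∈⁅x⁆)) x∈p)
  where
  p⊆⁅x⁆ : p ⊆ ⁅ x ⁆
  p⊆⁅x⁆ {y} y∈p with y ≟ x
  ... | yes refl = x∈⁅x⁆ x
  ... | no y≢x   = contradiction (y , x∈p∧x≢y⇒x∈p-y y∈p y≢x) empty

-- The minimum degree that forces a Berge path of length ℓ from every vertex.
threshold : ℕ → ℕ
threshold zero    = 1
threshold (suc ℓ) = 2 ^ ℓ + 1

1≤threshold : ∀ ℓ → 1 ≤ threshold ℓ
1≤threshold zero    = s≤s z≤n
1≤threshold (suc ℓ) = m≤n+m 1 (2 ^ ℓ)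

threshold-< : ∀ ℓ → threshold ℓ < threshold (suc ℓ)
threshold-< zero    = ≤-refl
threshold-< (suc ℓ) = +-monoˡ-< 1 (^-monoʳ-< 2 ≤-refl (n<1+n ℓ))

2≤threshold-suc : ∀ ℓ → 2 ≤ threshold (suc ℓ)
2≤threshold-suc ℓ = ≤-trans (s≤s (1≤threshold ℓ)) (threshold-< ℓ)

2*threshold≤1+threshold-suc : ∀ ℓ → 2 * threshold ℓ ≤ suc (threshold (suc ℓ))
2*threshold≤1+threshold-suc zero    = s≤s (s≤s z≤n)
2*threshold≤1+threshold-suc (suc ℓ) = ≤-reflexive (begin-equality
  2 * (2 ^ ℓ + 1)      ≡⟨ *-distribˡ-+ 2 (2 ^ ℓ) 1 ⟩
  2 * 2 ^ ℓ + 2        ≡⟨ +-suc (2 * 2 ^ ℓ) 1 ⟩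
  suc (2 * 2 ^ ℓ + 1)  ∎)
  where open ≤-Reasoning

threshold-step : ∀ ℓ {d k} → threshold (suc ℓ) ≤ d + k → d ≤ k ⊎ d ≤ 1 → threshold ℓ ≤ k
threshold-step ℓ {d} {k} t≤d+k (inj₁ d≤k) =
  ≤-pred (*-cancelˡ-< 2 (threshold ℓ) (suc k) (begin-strict
  2 * threshold ℓ          ≤⟨ 2*threshold≤1+threshold-suc ℓ ⟩
  suc (threshold (suc ℓ))  ≤⟨ s≤s t≤d+k ⟩
  suc (d + k)              ≤⟨ s≤s (+-monoˡ-≤ k d≤k) ⟩
  suc (k + k)              <⟨ n<1+n _ ⟩
  2 + (k + k)              ≡⟨ cong (λ m → 2 + (k + m)) (+-identityʳ k) ⟨
  2 + 2 * k                ≡⟨ *-suc 2 k ⟨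
  2 * suc k                ∎))
  where open ≤-Reasoning
threshold-step ℓ {d} {k} t≤d+k (inj₂ d≤1) = ≤-pred (begin
  suc (threshold ℓ)  ≤⟨ threshold-< ℓ ⟩
  threshold (suc ℓ)  ≤⟨ t≤d+k ⟩
  d + k              ≤⟨ +-monoˡ-≤ k d≤1 ⟩
  suc k              ∎)
  where open ≤-Reasoning

-- A simple hypergraph is a duplicate-free list of edges; its vertices are those lying in some edge,
-- which is why degree conditions and paths below only concern such vertices.
Occurs : List (Subset n) → Fin n → Set
Occurs E x = ∃ λ e → e ∈ˡ E × x ∈ e

deg : List (Subset n) → Fin n → ℕ
deg E x = length (filter (x ∈?_) E)

MinDegree : List (Subset n) → ℕ → Set
MinDegree E d = ∀ x → Occurs E x → d ≤ deg E x

0<deg⇒Occurs : ∀ {E : List (Subset n)} {x} → 0 < deg E x → Occurs E x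
0<deg⇒Occurs {x = x} 0<deg with 0<length⇒∃∈ 0<deg
... | e , e∈ = e , ∈-filter⁻ (x ∈?_) e∈

record Path (E : List (Subset n)) (v : Fin n) (ℓ : ℕ) : Set where
  field
    vert        : Fin (suc ℓ) → Fin n
    edg         : Fin ℓ → Subset n
    start       : vert zero ≡ v
    edg∈        : ∀ i → edg i ∈ˡ E
    vert-inj    : Injective _≡_ _≡_ vert
    edg-inj     : Injective _≡_ _≡_ edg
    incident    : ∀ i → vert (inject₁ i) ∈ edg i × vert (suc i) ∈ edg i
    vert-occurs : ∀ i → Occurs E (vert i)

trivialPath : ∀ {E : List (Subset n)} {v} → Occurs E v → Path E v 0
trivialPath {v = v} occ = record
  { vert = λ _ → v ; edg = λ () ; start = refl ; edg∈ = λ ()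
  ; vert-inj = λ { {zero} {zero} _ → refl } ; edg-inj = λ { {()} }
  ; incident = λ () ; vert-occurs = λ _ → occ }

CollapsingAt : List (Subset n) → Fin n → Subset n → Set
CollapsingAt E v e = v ∈ e × e - v ∈ˡ E

collapsingAt? : ∀ (E : List (Subset n)) v → Decidable (CollapsingAt E v)
collapsingAt? E v e = (v ∈? e) ×-dec any? (≡-dec _≟ᵇ_ (e - v)) E

2≤deg⇒∃nontrivialEdge : ∀ {E : List (Subset n)} {v} → Unique E → 2 ≤ deg E v →
                        ∃ λ e → e ∈ˡ E × v ∈ e × Nonempty (e - v)
2≤deg⇒∃nontrivialEdge {v = v} uE 2≤deg
  with Unique-distinct-pair (Unique.filter⁺ (v ∈?_) uE) 2≤deg
... | a , b , a∈ , b∈ , a≢b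
  with ∈-filter⁻ (v ∈?_) a∈ | ∈-filter⁻ (v ∈?_) b∈ | nonempty? (a - v) | nonempty? (b - v)
... | a∈E , v∈a | _         | yes a-v≠∅ | _         = a , a∈E , v∈a , a-v≠∅
... | _         | b∈E , v∈b | no _      | yes b-v≠∅ = b , b∈E , v∈b , b-v≠∅
... | _ , v∈a   | _ , v∈b   | no a-v≡∅  | no b-v≡∅  =
  contradiction (trans (Empty[p-x]⇒p≡⁅x⁆ v∈a a-v≡∅) (sym (Empty[p-x]⇒p≡⁅x⁆ v∈b b-v≡∅))) a≢b

NoNontrivialCollapse : List (Subset n) → Fin n → Set
NoNontrivialCollapse E v = ¬ Any (λ e → CollapsingAt E v e × Nonempty (e - v)) E

firstEdge : ∀ {E : List (Subset n)} {v} → Unique E → 2 ≤ deg E v →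
            ∃ λ e₀ → e₀ ∈ˡ E × v ∈ e₀ × Nonempty (e₀ - v) ×
                     (CollapsingAt E v e₀ ⊎ NoNontrivialCollapse E v)
firstEdge {E = E} {v} uE 2≤deg with any? (λ e → collapsingAt? E v e ×-dec nonempty? (e - v)) E
... | yes collapse with find collapse
...   | e₀ , e₀∈E , c@(v∈e₀ , _) , e₀-v≠∅ = e₀ , e₀∈E , v∈e₀ , e₀-v≠∅ , inj₁ c
firstEdge uE 2≤deg | no ¬collapse with 2≤deg⇒∃nontrivialEdge uE 2≤deg
... | e₀ , e₀∈E , v∈e₀ , e₀-v≠∅ = e₀ , e₀∈E , v∈e₀ , e₀-v≠∅ , inj₂ ¬collapse

module Deletion {E : List (Subset n)} (uE : Unique E) {v e₀} (e₀∈E : e₀ ∈ˡ E) (v∈e₀ : v ∈ e₀) where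

  Dropped : Subset n → Set
  Dropped e = e ≡ e₀ ⊎ CollapsingAt E v e

  dropped? : Decidable Dropped
  dropped? e = ≡-dec _≟ᵇ_ e e₀ ⊎-dec collapsingAt? E v e

  kept : List (Subset n)
  kept = filter (∁? dropped?) E

  E⁻ : List (Subset n)
  E⁻ = map (_- v) kept

  droppedAt keptAt : Fin n → List (Subset n)
  droppedAt x = filter dropped? (filter (x ∈?_) E)
  keptAt    x = filter (∁? dropped?) (filter (x ∈?_) E)

  ¬Dropped[e-v] : ∀ e → ¬ Dropped (e - v)
  ¬Dropped[e-v] e (inj₁ e-v≡e₀)    = x∉p-x e v (subst (v ∈_) (sym e-v≡e₀) v∈e₀)
  ¬Dropped[e-v] e (inj₂ (v∈e-v , _)) = x∉p-x e v v∈e-v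

  Unique-E⁻ : Unique E⁻
  Unique-E⁻ = map⁺-injectiveOn -v-injective (Unique.filter⁺ (∁? dropped?) uE)
    where
    -v-injective : ∀ {a b} → a ∈ˡ kept → b ∈ˡ kept → a - v ≡ b - v → a ≡ b
    -v-injective {a} {b} a∈ b∈ eq
      with ∈-filter⁻ (∁? dropped?) a∈ | ∈-filter⁻ (∁? dropped?) b∈ | v ∈? a | v ∈? b
    ... | _ | _ | yes v∈a | yes v∈b = p-x≡q-x⇒p≡q v∈a v∈b eq
    ... | _ , a-kept | b∈E , _ | yes v∈a | no v∉b =
      contradiction (inj₂ (v∈a , subst (_∈ˡ E) (sym (trans eq (x∉p⇒p-x≡p v∉b))) b∈E)) a-kept
    ... | a∈E , _ | _ , b-kept | no v∉a | yes v∈b =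
      contradiction (inj₂ (v∈b , subst (_∈ˡ E) (sym (trans (sym eq) (x∉p⇒p-x≡p v∉a))) a∈E)) b-kept
    ... | _ | _ | no v∉a | no v∉b = trans (sym (x∉p⇒p-x≡p v∉a)) (trans eq (x∉p⇒p-x≡p v∉b))

  Occurs-E⁻⇒Occurs-E : ∀ {x} → Occurs E⁻ x → Occurs E x × x ≢ v
  Occurs-E⁻⇒Occurs-E (_ , e-v∈E⁻ , x∈e-v) with ∈-map⁻ (_- v) e-v∈E⁻
  ... | e , e∈kept , refl =
    (e , proj₁ (∈-filter⁻ (∁? dropped?) e∈kept) , p-x⊆p x∈e-v) , x∈p-y⇒x≢y x∈e-v

  deg-E⁻≡keptAt : ∀ {x} → x ≢ v → deg E⁻ x ≡ length (keptAt x)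
  deg-E⁻≡keptAt {x} x≢v = begin
    length (filter (x ∈?_) (map (_- v) kept))  ≡⟨ cong length (filter-map (x ∈?_) (_- v) kept) ⟩
    length (map (_- v) (filter x∈?-v kept))    ≡⟨ length-map (_- v) (filter x∈?-v kept) ⟩
    length (filter x∈?-v kept)                 ≡⟨ cong length (filter-≐ x∈?-v (x ∈?_) x∈p-v⇔x∈p kept) ⟩
    length (filter (x ∈?_) kept)               ≡⟨ cong length (filter-comm (x ∈?_) (∁? dropped?) E) ⟩
    length (keptAt x)                          ∎
    where
    open ≡-Reasoning
    x∈?-v : Decidable (λ e → x ∈ e - v)
    x∈?-v = (x ∈?_) ∘ (_- v)
    x∈p-v⇔x∈p : (λ e → x ∈ e - v) ≐ (x ∈_)
    x∈p-v⇔x∈p = p-x⊆p , λ x∈e → x∈p∧x≢y⇒x∈p-y x∈e x≢v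

  droppedAt+keptAt≡deg : ∀ x → length (droppedAt x) + length (keptAt x) ≡ deg E x
  droppedAt+keptAt≡deg x = length-filter+length-filter-∁ dropped? (filter (x ∈?_) E)

  ∈-droppedAt⁻ : ∀ {x d} → d ∈ˡ droppedAt x → d ∈ˡ E × x ∈ d × Dropped d
  ∈-droppedAt⁻ {x} d∈ with ∈-filter⁻ dropped? d∈
  ... | d∈Eₓ , dropped = Product.map₂ (_, dropped) (∈-filter⁻ (x ∈?_) d∈Eₓ)

  Unique-droppedAt : ∀ x → Unique (droppedAt x)
  Unique-droppedAt x = Unique.filter⁺ dropped? (Unique.filter⁺ (x ∈?_) uE)

  droppedAt≤keptAt : CollapsingAt E v e₀ → ∀ {x} → x ≢ v → length (droppedAt x) ≤ length (keptAt x)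
  droppedAt≤keptAt e₀-collapsing {x} x≢v = begin
    length (droppedAt x)               ≡⟨ length-map (_- v) (droppedAt x) ⟨
    length (map (_- v) (droppedAt x))  ≤⟨ Unique-length-≤ Unique-image ⊆keptAt ⟩
    length (keptAt x)                  ∎
    where
    open ≤-Reasoning
    collapsing : ∀ {d} → Dropped d → CollapsingAt E v d
    collapsing (inj₁ refl) = e₀-collapsing
    collapsing (inj₂ c)    = c
    v∈ : ∀ {d} → d ∈ˡ droppedAt x → v ∈ d
    v∈ d∈ = proj₁ (collapsing (proj₂ (proj₂ (∈-droppedAt⁻ d∈))))
    Unique-image : Unique (map (_- v) (droppedAt x))
    Unique-image = map⁺-injectiveOn (λ a∈ b∈ → p-x≡q-x⇒p≡q (v∈ a∈) (v∈ b∈)) (Unique-droppedAt x)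
    ⊆keptAt : ∀ {e} → e ∈ˡ map (_- v) (droppedAt x) → e ∈ˡ keptAt x
    ⊆keptAt e∈ with ∈-map⁻ (_- v) e∈
    ... | d , d∈ , refl with ∈-droppedAt⁻ d∈
    ... | _ , x∈d , dropped =
      let d-v∈E = proj₂ (collapsing dropped) in
      ∈-filter⁺ (∁? dropped?) (∈-filter⁺ (x ∈?_) d-v∈E (x∈p∧x≢y⇒x∈p-y x∈d x≢v)) (¬Dropped[e-v] d)

  droppedAt≤1 : NoNontrivialCollapse E v → ∀ {x} → x ≢ v → length (droppedAt x) ≤ 1
  droppedAt≤1 ¬collapse {x} x≢v = Unique-length-≤ {ys = [ e₀ ]} (Unique-droppedAt x) (here ∘ ≡e₀)
    where
    ≡e₀ : ∀ {d} → d ∈ˡ droppedAt x → d ≡ e₀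
    ≡e₀ d∈ with ∈-droppedAt⁻ d∈
    ... | _   , _   , inj₁ d≡e₀ = d≡e₀
    ... | d∈E , x∈d , inj₂ c    = contradiction (lose d∈E (c , x , x∈p∧x≢y⇒x∈p-y x∈d x≢v)) ¬collapse

  threshold≤deg-E⁻ : ∀ {ℓ} → MinDegree E (threshold (suc ℓ)) →
                     CollapsingAt E v e₀ ⊎ NoNontrivialCollapse E v →
                     ∀ {x} → x ≢ v → Occurs E x → threshold ℓ ≤ deg E⁻ x
  threshold≤deg-E⁻ {ℓ} δ case {x} x≢v occ = subst (threshold ℓ ≤_) (sym (deg-E⁻≡keptAt x≢v))
    (threshold-step ℓ (subst (threshold (suc ℓ) ≤_) (sym (droppedAt+keptAt≡deg x)) (δ x occ)) bound)
    where
    bound : length (droppedAt x) ≤ length (keptAt x) ⊎ length (droppedAt x) ≤ 1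
    bound = Sum.map (λ c → droppedAt≤keptAt c x≢v) (λ ¬c → droppedAt≤1 ¬c x≢v) case

  extend : ∀ {w ℓ} → w ∈ e₀ → Path E⁻ w ℓ → Path E v (suc ℓ)
  extend {w} {ℓ} w∈e₀ p = record
    { vert = v Vector.∷ P.vert
    ; edg = e₀ Vector.∷ lift
    ; start = refl
    ; edg∈ = λ { zero → e₀∈E ; (suc i) → proj₁ (lift-kept i) }
    ; vert-inj = ∷-injective (λ i → proj₂ (Occurs-E⁻⇒Occurs-E (P.vert-occurs i))) P.vert-inj
    ; edg-inj = ∷-injective (λ i lift≡e₀ → proj₂ (lift-kept i) (inj₁ lift≡e₀)) lift-inj
    ; incident = λ { zero → v∈e₀ , subst (_∈ e₀) (sym P.start) w∈e₀
                   ; (suc i) → Product.map (⊆lift i) (⊆lift i) (P.incident i) }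
    ; vert-occurs = λ { zero → e₀ , e₀∈E , v∈e₀
                      ; (suc i) → proj₁ (Occurs-E⁻⇒Occurs-E (P.vert-occurs i)) }
    }
    where
    module P = Path p
    preimage : ∀ i → ∃ λ e → e ∈ˡ kept × P.edg i ≡ e - v
    preimage i = ∈-map⁻ (_- v) (P.edg∈ i)
    lift : Fin ℓ → Subset n
    lift i = proj₁ (preimage i)
    lift-kept : ∀ i → lift i ∈ˡ E × ¬ Dropped (lift i)
    lift-kept i = ∈-filter⁻ (∁? dropped?) (proj₁ (proj₂ (preimage i)))
    ⊆lift : ∀ i → P.edg i ⊆ lift i
    ⊆lift i y∈ = p-x⊆p (subst (_ ∈_) (proj₂ (proj₂ (preimage i))) y∈)
    lift-inj : Injective _≡_ _≡_ lift
    lift-inj {i} {j} eq = P.edg-inj (trans (proj₂ (proj₂ (preimage i)))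
                                    (trans (cong (_- v) eq) (sym (proj₂ (proj₂ (preimage j))))))

pathFrom : ∀ ℓ {E : List (Subset n)} → Unique E → MinDegree E (threshold ℓ) →
           ∀ {v} → Occurs E v → Path E v ℓ
pathFrom zero    _  _ occ = trivialPath occ
pathFrom (suc ℓ) {E} uE δ {v} occ with firstEdge uE (≤-trans (2≤threshold-suc ℓ) (δ v occ))
... | e₀ , e₀∈E , v∈e₀ , (w , w∈e₀-v) , case = extend (p-x⊆p w∈e₀-v) (pathFrom ℓ Unique-E⁻ δ⁻ occ-w)
  where
  open Deletion uE e₀∈E v∈e₀
  bound : ∀ {x} → x ≢ v → Occurs E x → threshold ℓ ≤ deg E⁻ x
  bound = threshold≤deg-E⁻ {ℓ} δ case
  δ⁻ : MinDegree E⁻ (threshold ℓ)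
  δ⁻ x occ⁻ = let (occ , x≢v) = Occurs-E⁻⇒Occurs-E occ⁻ in bound x≢v occ
  occ-w : Occurs E⁻ w
  occ-w = 0<deg⇒Occurs
    (≤-trans (1≤threshold ℓ) (bound (x∈p-y⇒x≢y w∈e₀-v) (e₀ , e₀∈E , p-x⊆p w∈e₀-v)))

module _ (H : Hypergraph n) where

  edges : List (Subset n)
  edges = map (edge H) (allFin (m H))

  Unique-edges : Unique edges
  Unique-edges = Unique.map⁺ (simple H) (Unique.allFin⁺ (m H))

  deg-edges : ∀ x → deg edges x ≡ degree H x
  deg-edges x = trans (cong length (filter-map (x ∈?_) (edge H) (allFin (m H))))
                      (length-map (edge H) (filter (λ i → x ∈? edge H i) (allFin (m H))))

  toBergePath : ∀ {v ℓ} → Path edges v ℓ → BergePath H ℓ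
  toBergePath {ℓ = ℓ} p = record
    { vert = P.vert ; edg = edgeIndex ; vert-inj = P.vert-inj
    ; edg-inj = λ {i} {j} eq → P.edg-inj (trans (edg≡ i) (trans (cong (edge H) eq) (sym (edg≡ j))))
    ; incident = λ i → Product.map (subst (_ ∈_) (edg≡ i)) (subst (_ ∈_) (edg≡ i)) (P.incident i)
    }
    where
    module P = Path p
    edgeIndex : Fin ℓ → Fin (m H)
    edgeIndex i = proj₁ (∈-map⁻ (edge H) (P.edg∈ i))
    edg≡ : ∀ i → P.edg i ≡ edge H (edgeIndex i)
    edg≡ i = proj₂ (proj₂ (∈-map⁻ (edge H) (P.edg∈ i)))

theorem2p2 : (k n : ℕ) → 2 ≤ k → (H : Hypergraph (suc n)) →
    MinDegreeAtLeast H (2 ^ (k ∸ 2) + 1) → HasBergePathWithBase H k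
theorem2p2 (suc zero)    n (s≤s ()) H δ
theorem2p2 (suc (suc j)) n _ H δ =
  toBergePath H (pathFrom (suc j) (Unique-edges H) (λ x _ → δ-edges x) occ-zero)
  where
  δ-edges : ∀ x → threshold (suc j) ≤ deg (edges H) x
  δ-edges x = subst (threshold (suc j) ≤_) (sym (deg-edges H x)) (δ x)
  occ-zero : Occurs (edges H) zero
  occ-zero = 0<deg⇒Occurs (≤-trans (1≤threshold (suc j)) (δ-edges zero))
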